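{- Let $n\geq 2$ be an integer and $K\subseteq\mathbb{R}$, and assume that $n$ is even or $K=\mathbb{Z}$. Then $E_K(n,n-1)=n$; that is, every orthoregular system of $n-1$ vectors in $\mathbb{Z}^n$ whose length lies in $K$ can be extended to an orthoregular system of $n$ vectors in $\mathbb{Z}^n$.
   Context: A system $v_1,\ldots,v_k$ of vectors in $\mathbb{R}^n$ is called orthoregular if (i) $v_i\perp v_j$ (standard inner product) for $i\neq j$, and (ii) $|v_i|=|v_j|\neq 0$ for all $i,j$ ($|\cdot|$ the Euclidean norm); the common value $|v_i|$ is the length of the system. For an orthoregular system $S\subset\mathbb{Z}^n$, $E(S)$ denotes the maximum number of vectors in an orthoregular system of integer vectors in $\mathbb{Z}^n$ containing (extending) $S$. For an integer $0<k<n$ and a subset $K\subseteq\mathbb{R}$, $E_K(n,k)$ denotes the minimum of $E(S)$ over all orthoregular systems $S\subset\mathbb{Z}^n$ with $k$ elements whose length lies in $K$. -}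

module Defs where

open import Data.Nat using (ℕ; zero; suc)
open import Data.Fin using (Fin; zero; suc)
open import Data.Integer using (ℤ; _+_; _*_; 0ℤ)
open import Data.Product using (_×_; ∃)
open import Relation.Binary.PropositionalEquality using (_≡_; _≢_)

IVec : ℕ → Set
IVec n = Fin n → ℤ

dot : ∀ {n} → IVec n → IVec n → ℤ
dot {zero}  u v = 0ℤ
dot {suc n} u v = u zero * v zero + dot (λ i → u (suc i)) (λ i → v (suc i))

normSq : ∀ {n} → IVec n → ℤ
normSq v = dot v v

-- A system v_1,…,v_k of vectors in ℤ^n is orthoregular if the vectors are
-- pairwise orthogonal and have a common nonzero length.
-- (|v_i| = |v_j| ⇔ |v_i|^2 = |v_j|^2, and |v_i| ≠ 0 ⇔ |v_i|^2 ≠ 0.)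
Orthoregular : ∀ {n k} → (Fin k → IVec n) → Set
Orthoregular {n} {k} S =
  (∀ (i j : Fin k) → i ≢ j → dot (S i) (S j) ≡ 0ℤ) ×
  (∀ (i j : Fin k) → normSq (S i) ≡ normSq (S j)) ×
  (∀ (i : Fin k) → normSq (S i) ≢ 0ℤ)

Contains : ∀ {n k m} → (Fin m → IVec n) → (Fin k → IVec n) → Set
Contains {k = k} {m = m} T S = ∀ (i : Fin k) → ∃ λ (j : Fin m) → T j ≡ S i

{-# OPTIONS --safe #-}
-- Let L be the common squared length and m = n - 1. The matrix Q = L·I - Sᵀ S is L times the
-- orthogonal projection onto the line orthogonal to S: its rows are orthogonal to every S i,
-- Q k · Q j = L Q k j, and its trace is n L - m L = L, so some Q j j is nonzero. As the
-- orthogonal complement of S is a line, Q has rank one: Q j j Q k k = Q j k ². The rows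
-- Q j, S 1, …, S m are n orthogonal vectors of ℤⁿ, so the product L Q j j · Lᵐ of their squared
-- lengths is the square of their determinant; since Lⁿ is a square (n even or L a square),
-- Q j j = d² is a square as well. Then d divides every Q j k, and u = Q j / d is an integer
-- vector orthogonal to S with |u|² = Σ u k² = Σ Q k k = L.
--
-- That at most n nonzero orthogonal vectors fit in ℤⁿ, and that the product of the squared
-- lengths of n of them is a square, is proved by eliminating the first coordinate: the vectors
-- are added one at a time, and a pair with nonzero leading entries is rotated, inside its
-- integral span, into an orthogonal pair one of which has leading entry 0.
module Submission where

open import Defs
open import Data.Nat using (ℕ; _≤_; _∸_)
open import Data.Nat.Divisibility using (_∣_)
open import Data.Fin using (Fin)
open import Data.Integer using (ℤ; _*_)
open import Data.Product using (_×_; ∃; Σ)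
open import Data.Sum using (_⊎_)
open import Relation.Binary.PropositionalEquality using (_≡_)

open import Data.Nat as ℕ using (zero; suc; s≤s; z≤n)
import Data.Nat.Properties as ℕP
open import Data.Nat.Divisibility as ℕ∣ using (divides)
open import Data.Nat.DivMod using (_/_; m/n*n≡m)
open import Data.Nat.GCD using (gcd; gcd[m,n]∣m; gcd[m,n]∣n; gcd[m,n]≢0)
open import Data.Nat.Coprimality using (coprime-/gcd; coprime-divisor)
import Data.Nat.Tactic.RingSolver as ℕSolver
open import Data.Fin using (zero; suc)
import Data.Fin.Properties as FinP
open import Data.Integer as ℤ using (_+_; -_; _-_; +_; 0ℤ; 1ℤ; _^_)
import Data.Integer.Properties as ℤP
import Data.Integer.Divisibility.Signed as ℤ∣
open import Data.Integer.Tactic.RingSolver using (solve-∀)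
open import Algebra.Properties.CommutativeSemigroup ℤP.*-commutativeSemigroup using (x∙yz≈y∙xz)
open import Algebra.Properties.Semiring.Sum ℤP.+-*-semiring
  using (sum; ∑-comm; *-distribˡ-sum; sum-cong-≗; sum-replicate-zero)
open import Data.Vec.Functional using (tail) renaming (_∷_ to _◂_)
open import Function using (_∘_)
open import Data.Product using (_,_; proj₁; proj₂)
open import Data.Sum using (inj₁; inj₂; map₂)
open import Data.Empty using (⊥-elim)
open import Relation.Nullary using (yes; no)
open import Relation.Nullary.Decidable using (decidable-stable)
open import Relation.Binary.PropositionalEquality
  using (_≢_; refl; sym; trans; cong; cong₂; subst; subst₂; module ≡-Reasoning)
open import Data.List using (List; []; _∷_; length; tabulate)
open import Data.List.Properties using (length-tabulate)
open import Data.List.Relation.Unary.All as All using (All; []; _∷_)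
open import Data.List.Relation.Unary.All.Properties using (tabulate⁺)
open import Data.List.Relation.Unary.AllPairs using (AllPairs; []; _∷_)


dot≡∑ : ∀ {n} (u v : IVec n) → dot u v ≡ sum (λ k → u k * v k)
dot≡∑ {zero}  u v = refl
dot≡∑ {suc n} u v = cong (_+_ (u zero * v zero)) (dot≡∑ (tail u) (tail v))

dot-comm : ∀ {n} (u v : IVec n) → dot u v ≡ dot v u
dot-comm {zero}  u v = refl
dot-comm {suc n} u v = cong₂ _+_ (ℤP.*-comm (u zero) (v zero)) (dot-comm (tail u) (tail v))

dot-head≡0 : ∀ {n} (u v : IVec (suc n)) → v zero ≡ 0ℤ → dot u v ≡ dot (tail u) (tail v)
dot-head≡0 u v v₀≡0 rewrite v₀≡0 | ℤP.*-zeroʳ (u zero) = ℤP.+-identityˡ _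

⊥-tail : ∀ {n} (u v : IVec (suc n)) → v zero ≡ 0ℤ → dot u v ≡ 0ℤ → dot (tail u) (tail v) ≡ 0ℤ
⊥-tail u v v₀≡0 u⊥v = trans (sym (dot-head≡0 u v v₀≡0)) u⊥v

normSq-tail : ∀ {n} (v : IVec (suc n)) → v zero ≡ 0ℤ → normSq v ≡ normSq (tail v)
normSq-tail v = dot-head≡0 v v

combine : ∀ {n} → ℤ → IVec n → ℤ → IVec n → IVec n
combine a x b y k = a * x k + b * y k

zero-combination : ∀ a b → a * 0ℤ + b * 0ℤ ≡ 0ℤ
zero-combination = solve-∀

dot-combineˡ : ∀ {n} a (x : IVec n) b y w → dot (combine a x b y) w ≡ a * dot x w + b * dot y w
dot-combineˡ {zero}  a x b y w = sym (zero-combination a b)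
dot-combineˡ {suc n} a x b y w
  rewrite dot-combineˡ a (tail x) b (tail y) (tail w) = distribute a b (x zero) (y zero) (w zero) _ _
  where
  distribute : ∀ a b x y w X Y → (a * x + b * y) * w + (a * X + b * Y) ≡ a * (x * w + X) + b * (y * w + Y)
  distribute = solve-∀

dot-combineʳ : ∀ {n} (w : IVec n) a x b y → dot w (combine a x b y) ≡ a * dot w x + b * dot w y
dot-combineʳ w a x b y = begin
  dot w (combine a x b y)    ≡⟨ dot-comm w _ ⟩
  dot (combine a x b y) w    ≡⟨ dot-combineˡ a x b y w ⟩
  a * dot x w + b * dot y w  ≡⟨ cong₂ (λ p q → a * p + b * q) (dot-comm x w) (dot-comm y w) ⟩
  a * dot w x + b * dot w y  ∎
  where open ≡-Reasoning

⊥-combine : ∀ {n} (w : IVec n) a x b y → dot w x ≡ 0ℤ → dot w y ≡ 0ℤ → dot w (combine a x b y) ≡ 0ℤ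
⊥-combine w a x b y w⊥x w⊥y =
  trans (dot-combineʳ w a x b y) (trans (cong₂ (λ p q → a * p + b * q) w⊥x w⊥y) (zero-combination a b))

dot-combine-combine : ∀ {n} a b c d (x y : IVec n) →
  dot (combine a x b y) (combine c x d y) ≡ a * c * normSq x + (a * d + b * c) * dot x y + b * d * normSq y
dot-combine-combine a b c d x y
  rewrite dot-combineˡ a x b y (combine c x d y)
        | dot-combineʳ x c x d y | dot-combineʳ y c x d y | dot-comm y x
  = expand a b c d (normSq x) (dot x y) (normSq y)
  where
  expand : ∀ a b c d X Z Y → a * (c * X + d * Z) + b * (c * Z + d * Y) ≡ a * c * X + (a * d + b * c) * Z + b * d * Y
  expand = solve-∀

dot-combine-⊥ : ∀ {n} a b c d (x y : IVec n) → dot x y ≡ 0ℤ →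
  dot (combine a x b y) (combine c x d y) ≡ a * c * normSq x + b * d * normSq y
dot-combine-⊥ a b c d x y x⊥y = begin
  dot (combine a x b y) (combine c x d y)                          ≡⟨ dot-combine-combine a b c d x y ⟩
  a * c * normSq x + (a * d + b * c) * dot x y + b * d * normSq y  ≡⟨ cong (λ t → a * c * normSq x + (a * d + b * c) * t + _) x⊥y ⟩
  a * c * normSq x + (a * d + b * c) * 0ℤ + b * d * normSq y       ≡⟨ drop-middle (a * c * normSq x) (a * d + b * c) (b * d * normSq y) ⟩
  a * c * normSq x + b * d * normSq y                              ∎
  where
  open ≡-Reasoning
  drop-middle : ∀ p q r → p + q * 0ℤ + r ≡ p + r
  drop-middle = solve-∀

Orthogonal : ∀ {n} → List (IVec n) → Set
Orthogonal = AllPairs (λ u v → dot u v ≡ 0ℤ)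

Nonzero : ∀ {n} → List (IVec n) → Set
Nonzero = All (λ v → normSq v ≢ 0ℤ)

infix 4 _⊥_

_⊥_ : ∀ {n} → IVec n → List (IVec n) → Set
x ⊥ ws = All (λ w → dot x w ≡ 0ℤ) ws

combine-⊥ : ∀ {n} a (x : IVec n) b y {ws} → x ⊥ ws → y ⊥ ws → combine a x b y ⊥ ws
combine-⊥ a x b y x⊥ws y⊥ws = All.zipWith
  (λ {w} (x⊥w , y⊥w) → trans (dot-comm _ w)
                               (⊥-combine w a x b y (trans (dot-comm w x) x⊥w) (trans (dot-comm w y) y⊥w)))
  (x⊥ws , y⊥ws)

normProduct : ∀ {n} → List (IVec n) → ℤ
normProduct []       = 1ℤ
normProduct (v ∷ vs) = normSq v * normProduct vs

square≡∣∣*∣∣ : ∀ i → i * i ≡ + (ℤ.∣ i ∣ ℕ.* ℤ.∣ i ∣)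
square≡∣∣*∣∣ (+ n)      = sym (ℤP.pos-* n n)
square≡∣∣*∣∣ ℤ.-[1+ n ] = refl

normSq-nonneg : ∀ {n} (v : IVec n) → ∃ λ a → normSq v ≡ + a
normSq-nonneg {zero}  v = 0 , refl
normSq-nonneg {suc n} v with normSq-nonneg (tail v)
... | a , eq = ℤ.∣ v zero ∣ ℕ.* ℤ.∣ v zero ∣ ℕ.+ a , cong₂ _+_ (square≡∣∣*∣∣ (v zero)) eq

*-≢0 : ∀ {i j} → i ≢ 0ℤ → j ≢ 0ℤ → i * j ≢ 0ℤ
*-≢0 {i} i≢0 j≢0 ij≡0 with ℤP.i*j≡0⇒i≡0∨j≡0 i ij≡0
... | inj₁ i≡0 = i≢0 i≡0
... | inj₂ j≡0 = j≢0 j≡0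

*-cancelˡ-≡0 : ∀ {i j} → i ≢ 0ℤ → i * j ≡ 0ℤ → j ≡ 0ℤ
*-cancelˡ-≡0 {i} i≢0 ij≡0 with ℤP.i*j≡0⇒i≡0∨j≡0 i ij≡0
... | inj₁ i≡0 = ⊥-elim (i≢0 i≡0)
... | inj₂ j≡0 = j≡0

weighted-squares-≢0 : ∀ a b {X Y} → (∃ λ x → X ≡ + x) → (∃ λ y → Y ≡ + y) →
  b ≢ 0ℤ → Y ≢ 0ℤ → a * a * X + b * b * Y ≢ 0ℤ
weighted-squares-≢0 a b (x , refl) (y , refl) b≢0 Y≢0 sum≡0 =
  *-≢0 (*-≢0 b≢0 b≢0) Y≢0 (trans (square*-pos b y) (cong +_ (ℕP.m+n≡0⇒n≡0 _ (ℤP.+-injective sum≡0′))))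
  where
  square*-pos : ∀ i z → i * i * + z ≡ + (ℤ.∣ i ∣ ℕ.* ℤ.∣ i ∣ ℕ.* z)
  square*-pos i z = trans (cong (_* + z) (square≡∣∣*∣∣ i)) (sym (ℤP.pos-* (ℤ.∣ i ∣ ℕ.* ℤ.∣ i ∣) z))
  sum≡0′ : + (ℤ.∣ a ∣ ℕ.* ℤ.∣ a ∣ ℕ.* x ℕ.+ ℤ.∣ b ∣ ℕ.* ℤ.∣ b ∣ ℕ.* y) ≡ + 0
  sum≡0′ = trans (sym (cong₂ _+_ (square*-pos a x) (square*-pos b y))) sum≡0

m*m∣n*n⇒m∣n : ∀ m n → m ℕ.* m ∣ n ℕ.* n → m ∣ n
m*m∣n*n⇒m∣n zero n (divides q n*n≡q*0) with ℕP.m*n≡0⇒m≡0∨n≡0 n (trans n*n≡q*0 (ℕP.*-zeroʳ q))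
... | inj₁ refl = ℕ∣.∣-refl
... | inj₂ refl = ℕ∣.∣-refl
m*m∣n*n⇒m∣n m@(suc _) n m*m∣n*n = subst (_∣ n) (sym m≡g) (gcd[m,n]∣n m n)
  where
  g = gcd m n
  instance
    g≢0 : ℕ.NonZero g
    g≢0 = ℕ.≢-nonZero (gcd[m,n]≢0 m n (inj₁ (λ ())))
    g*g≢0 : ℕ.NonZero (g ℕ.* g)
    g*g≢0 = ℕP.m*n≢0 g g
  a = m / g
  b = n / g
  m≡a*g : m ≡ a ℕ.* g
  m≡a*g = sym (m/n*n≡m (gcd[m,n]∣m m n))
  n≡b*g : n ≡ b ℕ.* g
  n≡b*g = sym (m/n*n≡m (gcd[m,n]∣n m n))
  regroup : ∀ x y → x ℕ.* y ℕ.* (x ℕ.* y) ≡ x ℕ.* x ℕ.* (y ℕ.* y)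
  regroup = ℕSolver.solve-∀
  a*a∣b*b : a ℕ.* a ∣ b ℕ.* b
  a*a∣b*b = ℕ∣.*-cancelʳ-∣ (g ℕ.* g) (subst₂ _∣_
    (trans (cong₂ ℕ._*_ m≡a*g m≡a*g) (regroup a g)) (trans (cong₂ ℕ._*_ n≡b*g n≡b*g) (regroup b g)) m*m∣n*n)
  a≡1 : a ≡ 1
  a≡1 = coprime-/gcd m n (ℕ∣.∣-refl , coprime-divisor (coprime-/gcd m n) (ℕ∣.∣-trans (ℕ∣.m∣m*n a) a*a∣b*b))
  m≡g : m ≡ g
  m≡g = trans m≡a*g (trans (cong (ℕ._* g) a≡1) (ℕP.*-identityˡ g))

square-quotient : ∀ d r e → d ≢ 0ℤ → d * d * r ≡ e * e → ∃ λ q → e ≡ q * d × r ≡ q * q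
square-quotient d r e d≢0 d*d*r≡e*e = q , e≡q*d , r≡q*q
  where
  ∣e∣² : ℤ.∣ e ∣ ℕ.* ℤ.∣ e ∣ ≡ ℤ.∣ r ∣ ℕ.* (ℤ.∣ d ∣ ℕ.* ℤ.∣ d ∣)
  ∣e∣² = begin
    ℤ.∣ e ∣ ℕ.* ℤ.∣ e ∣                 ≡⟨ ℤP.abs-* e e ⟨
    ℤ.∣ e * e ∣                         ≡⟨ cong ℤ.∣_∣ d*d*r≡e*e ⟨
    ℤ.∣ d * d * r ∣                     ≡⟨ ℤP.abs-* (d * d) r ⟩
    ℤ.∣ d * d ∣ ℕ.* ℤ.∣ r ∣             ≡⟨ cong (ℕ._* ℤ.∣ r ∣) (ℤP.abs-* d d) ⟩
    ℤ.∣ d ∣ ℕ.* ℤ.∣ d ∣ ℕ.* ℤ.∣ r ∣     ≡⟨ ℕP.*-comm _ ℤ.∣ r ∣ ⟩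
    ℤ.∣ r ∣ ℕ.* (ℤ.∣ d ∣ ℕ.* ℤ.∣ d ∣)   ∎
    where open ≡-Reasoning
  d∣e : d ℤ∣.∣ e
  d∣e = ℤ∣.∣ᵤ⇒∣ (m*m∣n*n⇒m∣n ℤ.∣ d ∣ ℤ.∣ e ∣ (divides ℤ.∣ r ∣ ∣e∣²))
  q = ℤ∣.quotient d∣e
  e≡q*d : e ≡ q * d
  e≡q*d = ℤ∣._∣_.equality d∣e
  instance
    d*d≢0 : ℤ.NonZero (d * d)
    d*d≢0 = ℤ.≢-nonZero (*-≢0 d≢0 d≢0)
  regroup : ∀ q d → q * d * (q * d) ≡ d * d * (q * q)
  regroup = solve-∀
  r≡q*q : r ≡ q * q
  r≡q*q = ℤP.*-cancelˡ-≡ (d * d) r (q * q) (trans d*d*r≡e*e (trans (cong₂ _*_ e≡q*d e≡q*d) (regroup q d)))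

^-≢0 : ∀ {i} n → i ≢ 0ℤ → i ^ n ≢ 0ℤ
^-≢0 {i} n i≢0 i^n≡0 = i≢0 (ℤP.i^n≡0⇒i≡0 i n i^n≡0)

square-^ : ∀ i n → (i * i) ^ n ≡ i ^ n * i ^ n
square-^ i zero    = refl
square-^ i (suc n) = trans (cong ((i * i) *_) (square-^ i n)) (regroup i (i ^ n))
  where
  regroup : ∀ i p → i * i * (p * p) ≡ i * p * (i * p)
  regroup = solve-∀

^-square : ∀ {L} n → L ≢ 0ℤ → 2 ∣ n ⊎ (∃ λ ℓ → L ≡ ℓ * ℓ) → ∃ λ s → s ≢ 0ℤ × L ^ n ≡ s * s
^-square {L} n L≢0 (inj₁ (divides q n≡q*2)) =
  L ^ q , ^-≢0 q L≢0 , trans (cong (L ^_) n≡q+q) (ℤP.^-distribˡ-+-* L q q)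
  where
  n≡q+q : n ≡ q ℕ.+ q
  n≡q+q = trans n≡q*2 (trans (ℕP.*-comm q 2) (cong (q ℕ.+_) (ℕP.+-identityʳ q)))
^-square {L} n L≢0 (inj₂ (ℓ , refl)) =
  ℓ ^ n , ^-≢0 n (λ ℓ≡0 → L≢0 (cong (λ x → x * x) ℓ≡0)) , square-^ ℓ n

-- x / y is the square of a nonzero rational.
infix 4 _≈□_

record _≈□_ (x y : ℤ) : Set where
  constructor by-squares
  field
    s t    : ℤ
    s≢0    : s ≢ 0ℤ
    t≢0    : t ≢ 0ℤ
    scaled : x * (s * s) ≡ y * (t * t)

≈□-refl : ∀ {x} → x ≈□ x
≈□-refl = by-squares 1ℤ 1ℤ (λ ()) (λ ()) refl

≈□-*ˡ : ∀ a {x y} → x ≈□ y → a * x ≈□ a * y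
≈□-*ˡ a {x} {y} (by-squares s t s≢0 t≢0 eq) =
  by-squares s t s≢0 t≢0 (trans (ℤP.*-assoc a x _) (trans (cong (a *_) eq) (sym (ℤP.*-assoc a y _))))

≈□-*-square : ∀ {x y} k → k ≢ 0ℤ → x ≈□ y → x ≈□ y * (k * k)
≈□-*-square {x} {y} k k≢0 (by-squares s t s≢0 t≢0 eq) =
  by-squares (s * k) t (*-≢0 s≢0 k≢0) t≢0 (trans (regroup x s k) (trans (cong (_* (k * k)) eq) (regroup' y t k)))
  where
  regroup : ∀ x s k → x * (s * k * (s * k)) ≡ x * (s * s) * (k * k)
  regroup = solve-∀
  regroup' : ∀ y t k → y * (t * t) * (k * k) ≡ y * (k * k) * (t * t)
  regroup' = solve-∀

module Rotation {n} (z v : IVec (suc n)) (z⊥v : dot z v ≡ 0ℤ) where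

  X Y K : ℤ
  X = normSq z
  Y = normSq v
  K = z zero * z zero * Y + v zero * v zero * X

  pivot residue : IVec (suc n)
  pivot   = combine (z zero * Y) z (v zero * X) v
  residue = combine (v zero) z (- z zero) v

  residue-head≡0 : residue zero ≡ 0ℤ
  residue-head≡0 = cancel (v zero) (z zero)
    where
    cancel : ∀ v₀ z₀ → v₀ * z₀ + - z₀ * v₀ ≡ 0ℤ
    cancel = solve-∀

  normSq-pivot : normSq pivot ≡ X * Y * K
  normSq-pivot = trans (dot-combine-⊥ (z zero * Y) (v zero * X) (z zero * Y) (v zero * X) z v z⊥v)
                       (expand (z zero) (v zero) X Y)
    where
    expand : ∀ z₀ v₀ X Y → z₀ * Y * (z₀ * Y) * X + v₀ * X * (v₀ * X) * Y ≡ X * Y * (z₀ * z₀ * Y + v₀ * v₀ * X)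
    expand = solve-∀

  normSq-residue : normSq residue ≡ K
  normSq-residue = trans (dot-combine-⊥ (v zero) (- z zero) (v zero) (- z zero) z v z⊥v)
                         (expand (z zero) (v zero) X Y)
    where
    expand : ∀ z₀ v₀ X Y → v₀ * v₀ * X + - z₀ * - z₀ * Y ≡ z₀ * z₀ * Y + v₀ * v₀ * X
    expand = solve-∀

  pivot⊥residue : dot pivot residue ≡ 0ℤ
  pivot⊥residue = trans (dot-combine-⊥ (z zero * Y) (v zero * X) (v zero) (- z zero) z v z⊥v)
                        (cancel (z zero) (v zero) X Y)
    where
    cancel : ∀ z₀ v₀ X Y → z₀ * Y * v₀ * X + v₀ * X * - z₀ * Y ≡ 0ℤ
    cancel = solve-∀

  K≢0 : v zero ≢ 0ℤ → X ≢ 0ℤ → K ≢ 0ℤ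
  K≢0 v₀≢0 X≢0 = weighted-squares-≢0 (z zero) (v zero) (normSq-nonneg v) (normSq-nonneg z) v₀≢0 X≢0

-- An orthogonal family vs in ℤ^(1+n), traded for an orthogonal family ws in ℤ^n (read as the
-- hyperplane of leading entry 0) and possibly one pivot z, all inside the rational span of vs.
data Elimination {n} (vs : List (IVec (suc n))) : Set where
  unpivoted : (ws : List (IVec n)) → length ws ≡ length vs → Orthogonal ws → Nonzero ws →
              normProduct vs ≈□ normProduct ws →
              (∀ x → x ⊥ vs → tail x ⊥ ws) → Elimination vs
  pivoted   : (z : IVec (suc n)) (ws : List (IVec n)) → suc (length ws) ≡ length vs →
              Orthogonal ws → Nonzero ws → tail z ⊥ ws → normSq z ≢ 0ℤ →
              normProduct vs ≈□ normSq z * normProduct ws →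
              (∀ x → x ⊥ vs → dot x z ≡ 0ℤ × tail x ⊥ ws) → Elimination vs

adjoin-headless : ∀ {n} {v : IVec (suc n)} {vs} → v zero ≡ 0ℤ → v ⊥ vs → normSq v ≢ 0ℤ →
  Elimination vs → Elimination (v ∷ vs)
adjoin-headless {v = v} {vs} v₀≡0 v⊥vs v≢0 (unpivoted ws len orth-ws nz-ws prod span) =
  unpivoted (tail v ∷ ws) (cong suc len) (span v v⊥vs ∷ orth-ws) (v≢0 ∘ trans (normSq-tail v v₀≡0) ∷ nz-ws)
    (subst (λ Y → normSq v * normProduct vs ≈□ Y * normProduct ws) (normSq-tail v v₀≡0) (≈□-*ˡ (normSq v) prod))
    (λ { x (x⊥v ∷ x⊥vs) → ⊥-tail x v v₀≡0 x⊥v ∷ span x x⊥vs })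
adjoin-headless {v = v} {vs} v₀≡0 v⊥vs v≢0 (pivoted z ws len orth-ws nz-ws tz⊥ws z≢0 prod span) =
  pivoted z (tail v ∷ ws) (cong suc len) (proj₂ (span v v⊥vs) ∷ orth-ws) (v≢0 ∘ trans (normSq-tail v v₀≡0) ∷ nz-ws)
    (⊥-tail z v v₀≡0 (trans (dot-comm z v) (proj₁ (span v v⊥vs))) ∷ tz⊥ws) z≢0
    (subst (normSq v * normProduct vs ≈□_)
           (trans (x∙yz≈y∙xz (normSq v) (normSq z) (normProduct ws))
                  (cong (λ Y → normSq z * (Y * normProduct ws)) (normSq-tail v v₀≡0)))
           (≈□-*ˡ (normSq v) prod))
    (λ { x (x⊥v ∷ x⊥vs) → proj₁ (span x x⊥vs) , ⊥-tail x v v₀≡0 x⊥v ∷ proj₂ (span x x⊥vs) })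

adjoin-leading : ∀ {n} {v : IVec (suc n)} {vs} → v zero ≢ 0ℤ → v ⊥ vs → normSq v ≢ 0ℤ →
  Elimination vs → Elimination (v ∷ vs)
adjoin-leading {v = v} v₀≢0 v⊥vs v≢0 (unpivoted ws len orth-ws nz-ws prod span) =
  pivoted v ws (cong suc len) orth-ws nz-ws (span v v⊥vs) v≢0 (≈□-*ˡ (normSq v) prod)
    (λ { x (x⊥v ∷ x⊥vs) → x⊥v , span x x⊥vs })
adjoin-leading {v = v} {vs} v₀≢0 v⊥vs v≢0 (pivoted z ws len orth-ws nz-ws tz⊥ws z≢0 prod span) =
  pivoted pivot (tail residue ∷ ws) (cong suc len)
    (combine-⊥ (v zero) (tail z) (- z zero) (tail v) tz⊥ws tv⊥ws ∷ orth-ws)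
    (K≢0 v₀≢0 z≢0 ∘ trans (sym normSq-tail-residue) ∷ nz-ws)
    (⊥-tail pivot residue residue-head≡0 pivot⊥residue
       ∷ combine-⊥ (z zero * Y) (tail z) (v zero * X) (tail v) tz⊥ws tv⊥ws)
    (*-≢0 (*-≢0 z≢0 v≢0) (K≢0 v₀≢0 z≢0) ∘ trans (sym normSq-pivot))
    (subst (Y * normProduct vs ≈□_) regroup (≈□-*-square K (K≢0 v₀≢0 z≢0) (≈□-*ˡ Y prod)))
    span′
  where
  z⊥v : dot z v ≡ 0ℤ
  z⊥v = trans (dot-comm z v) (proj₁ (span v v⊥vs))
  open Rotation z v z⊥v
  tv⊥ws : tail v ⊥ ws
  tv⊥ws = proj₂ (span v v⊥vs)
  normSq-tail-residue : normSq (tail residue) ≡ K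
  normSq-tail-residue = trans (sym (normSq-tail residue residue-head≡0)) normSq-residue
  regroup : Y * (X * normProduct ws) * (K * K) ≡ normSq pivot * (normSq (tail residue) * normProduct ws)
  regroup = trans (rearrange X Y K (normProduct ws))
                  (sym (cong₂ (λ p q → p * (q * normProduct ws)) normSq-pivot normSq-tail-residue))
    where
    rearrange : ∀ X Y K W → Y * (X * W) * (K * K) ≡ X * Y * K * (K * W)
    rearrange = solve-∀
  span′ : ∀ x → x ⊥ v ∷ vs → dot x pivot ≡ 0ℤ × tail x ⊥ tail residue ∷ ws
  span′ x (x⊥v ∷ x⊥vs) =
    ⊥-combine x (z zero * Y) z (v zero * X) v (proj₁ (span x x⊥vs)) x⊥v ,
    ⊥-tail x residue residue-head≡0 (⊥-combine x (v zero) z (- z zero) v (proj₁ (span x x⊥vs)) x⊥v)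
      ∷ proj₂ (span x x⊥vs)

eliminate : ∀ {n} (vs : List (IVec (suc n))) → Orthogonal vs → Nonzero vs → Elimination vs
eliminate []       []             []          = unpivoted [] refl [] [] ≈□-refl (λ _ _ → [])
eliminate (v ∷ vs) (v⊥vs ∷ orth) (v≢0 ∷ nz) with v zero ℤ.≟ 0ℤ
... | yes v₀≡0 = adjoin-headless v₀≡0 v⊥vs v≢0 (eliminate vs orth nz)
... | no  v₀≢0 = adjoin-leading v₀≢0 v⊥vs v≢0 (eliminate vs orth nz)

orthogonal-length≤ : ∀ {n} (vs : List (IVec n)) → Orthogonal vs → Nonzero vs → length vs ≤ n
orthogonal-length≤ {zero}  []       _ _         = z≤n
orthogonal-length≤ {zero}  (v ∷ vs) _ (v≢0 ∷ _) = ⊥-elim (v≢0 refl)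
orthogonal-length≤ {suc n} vs orth nz with eliminate vs orth nz
... | unpivoted ws len orth-ws nz-ws _ _ =
  subst (_≤ suc n) len (ℕP.m≤n⇒m≤1+n (orthogonal-length≤ ws orth-ws nz-ws))
... | pivoted _ ws len orth-ws nz-ws _ _ _ _ =
  subst (_≤ suc n) len (s≤s (orthogonal-length≤ ws orth-ws nz-ws))

orthogonal-length≢1+n : ∀ {n} (vs : List (IVec n)) → Orthogonal vs → Nonzero vs → length vs ≢ suc n
orthogonal-length≢1+n {n} vs orth nz len = ℕP.1+n≰n (subst (_≤ n) len (orthogonal-length≤ vs orth nz))

-- The product is the square of the determinant of vs.
orthogonal-basis-normProduct-square : ∀ {n} (vs : List (IVec n)) → length vs ≡ n →
  Orthogonal vs → Nonzero vs → ∃ λ t → normProduct vs ≡ t * t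
orthogonal-basis-normProduct-square {zero} [] _ _ _ = 1ℤ , refl
orthogonal-basis-normProduct-square {suc n} vs len orth nz with eliminate vs orth nz
... | unpivoted ws len′ orth-ws nz-ws _ _ = ⊥-elim (orthogonal-length≢1+n ws orth-ws nz-ws (trans len′ len))
... | pivoted z ws len′ orth-ws nz-ws tz⊥ws _ (by-squares s t s≢0 _ scaled) _ = proj₁ root , proj₂ (proj₂ root)
  where
  length-ws : length ws ≡ n
  length-ws = ℕP.suc-injective (trans len′ len)
  tail-z≡0 : normSq (tail z) ≡ 0ℤ
  tail-z≡0 = decidable-stable (normSq (tail z) ℤ.≟ 0ℤ) λ tz≢0 →
    orthogonal-length≢1+n (tail z ∷ ws) (tz⊥ws ∷ orth-ws) (tz≢0 ∷ nz-ws) (cong suc length-ws)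
  det : ∃ λ T → normProduct ws ≡ T * T
  det = orthogonal-basis-normProduct-square ws length-ws orth-ws nz-ws
  T = proj₁ det
  regroup : ∀ P s → P * (s * s) ≡ s * s * P
  regroup = solve-∀
  square : ∀ z₀ T t → (z₀ * z₀ + 0ℤ) * (T * T) * (t * t) ≡ z₀ * T * t * (z₀ * T * t)
  square = solve-∀
  s*s*P≡square : s * s * normProduct vs ≡ z zero * T * t * (z zero * T * t)
  s*s*P≡square = begin
    s * s * normProduct vs                      ≡⟨ regroup (normProduct vs) s ⟨
    normProduct vs * (s * s)                    ≡⟨ scaled ⟩
    normSq z * normProduct ws * (t * t)         ≡⟨ cong₂ (λ p q → (z zero * z zero + p) * q * _) tail-z≡0 (proj₂ det) ⟩
    (z zero * z zero + 0ℤ) * (T * T) * (t * t)  ≡⟨ square (z zero) T t ⟩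
    z zero * T * t * (z zero * T * t)           ∎
    where open ≡-Reasoning
  root : ∃ λ q → z zero * T * t ≡ q * s × normProduct vs ≡ q * q
  root = square-quotient s (normProduct vs) (z zero * T * t) s≢0 s*s*P≡square

δ : ∀ {n} → Fin n → Fin n → ℤ
δ zero    zero    = 1ℤ
δ zero    (suc _) = 0ℤ
δ (suc _) zero    = 0ℤ
δ (suc i) (suc j) = δ i j

δ-diag : ∀ {n} (i : Fin n) → δ i i ≡ 1ℤ
δ-diag zero    = refl
δ-diag (suc i) = δ-diag i

δ-off : ∀ {n} {i j : Fin n} → i ≢ j → δ i j ≡ 0ℤ
δ-off {i = zero}  {zero}  i≢j = ⊥-elim (i≢j refl)
δ-off {i = zero}  {suc j} i≢j = refl
δ-off {i = suc i} {zero}  i≢j = refl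
δ-off {i = suc i} {suc j} i≢j = δ-off (i≢j ∘ cong suc)

δ-comm : ∀ {n} (i j : Fin n) → δ i j ≡ δ j i
δ-comm zero    zero    = refl
δ-comm zero    (suc j) = refl
δ-comm (suc i) zero    = refl
δ-comm (suc i) (suc j) = δ-comm i j

∑-δ : ∀ {n} (x : IVec n) j → sum (λ k → x k * δ j k) ≡ x j
∑-δ {suc n} x zero = begin
  x zero * 1ℤ + sum (λ k → x (suc k) * 0ℤ)  ≡⟨ cong₂ _+_ (ℤP.*-identityʳ (x zero)) (sum-cong-≗ (ℤP.*-zeroʳ ∘ tail x)) ⟩
  x zero + sum {n} (λ _ → 0ℤ)               ≡⟨ cong (_+_ (x zero)) (sum-replicate-zero n) ⟩
  x zero + 0ℤ                               ≡⟨ ℤP.+-identityʳ (x zero) ⟩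
  x zero                                    ∎
  where open ≡-Reasoning
∑-δ {suc n} x (suc j) = trans (cong (_+ sum (λ k → x (suc k) * δ j k)) (ℤP.*-zeroʳ (x zero)))
                             (trans (ℤP.+-identityˡ _) (∑-δ (tail x) j))

∑-distrib-− : ∀ {n} (f g : IVec n) → sum (λ k → f k - g k) ≡ sum f - sum g
∑-distrib-− {zero}  f g = refl
∑-distrib-− {suc n} f g = trans (cong (_+_ (f zero - g zero)) (∑-distrib-− (tail f) (tail g)))
                               (regroup (f zero) (g zero) (sum (tail f)) (sum (tail g)))
  where
  regroup : ∀ a b A B → a - b + (A - B) ≡ a + A - (b + B)
  regroup = solve-∀

module Complement {n m} (S : Fin m → IVec n) (L : ℤ)
  (normSq-S : ∀ i → normSq (S i) ≡ L) (S-orth : ∀ i j → i ≢ j → dot (S i) (S j) ≡ 0ℤ) where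

  gram-S : ∀ i j → dot (S i) (S j) ≡ L * δ i j
  gram-S i j with i FinP.≟ j
  ... | yes refl = trans (normSq-S i) (sym (trans (cong (L *_) (δ-diag i)) (ℤP.*-identityʳ L)))
  ... | no i≢j   = trans (S-orth i j i≢j) (sym (trans (cong (L *_) (δ-off i≢j)) (ℤP.*-zeroʳ L)))

  -- L times the orthogonal projection onto the complement of the S i.
  Q : Fin n → IVec n
  Q j k = L * δ j k - sum (λ i → S i j * S i k)

  Q-sym : ∀ j k → Q j k ≡ Q k j
  Q-sym j k = cong₂ (λ a b → L * a - b) (δ-comm j k) (sum-cong-≗ (λ i → ℤP.*-comm (S i j) (S i k)))

  dot-Q : ∀ x j → dot x (Q j) ≡ L * x j - sum (λ i → S i j * dot x (S i))
  dot-Q x j = begin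
    dot x (Q j)
      ≡⟨ dot≡∑ x (Q j) ⟩
    sum (λ k → x k * (L * δ j k - sum (λ i → S i j * S i k)))
      ≡⟨ sum-cong-≗ (λ k → trans (distribute (x k) L (δ j k) _)
                                 (cong (λ t → L * (x k * δ j k) - t) (*-distribˡ-sum (x k) (λ i → S i j * S i k)))) ⟩
    sum (λ k → L * (x k * δ j k) - sum (λ i → x k * (S i j * S i k)))
      ≡⟨ ∑-distrib-− (λ k → L * (x k * δ j k)) (λ k → sum (λ i → x k * (S i j * S i k))) ⟩
    sum (λ k → L * (x k * δ j k)) - sum (λ k → sum (λ i → x k * (S i j * S i k)))
      ≡⟨ cong₂ _-_ (trans (sym (*-distribˡ-sum L (λ k → x k * δ j k))) (cong (L *_) (∑-δ x j)))
                   (∑-comm (λ k i → x k * (S i j * S i k))) ⟩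
    L * x j - sum (λ i → sum (λ k → x k * (S i j * S i k)))
      ≡⟨ cong (_-_ (L * x j)) (sum-cong-≗ inner) ⟩
    L * x j - sum (λ i → S i j * dot x (S i))
      ∎
    where
    open ≡-Reasoning
    distribute : ∀ x L d T → x * (L * d - T) ≡ L * (x * d) - x * T
    distribute = solve-∀
    exchange : ∀ x a b → x * (a * b) ≡ a * (x * b)
    exchange = solve-∀
    inner : ∀ i → sum (λ k → x k * (S i j * S i k)) ≡ S i j * dot x (S i)
    inner i = trans (sum-cong-≗ (λ k → exchange (x k) (S i j) (S i k)))
                    (trans (sym (*-distribˡ-sum (S i j) (λ k → x k * S i k))) (cong (S i j *_) (sym (dot≡∑ x (S i)))))

  S⊥Q : ∀ a j → dot (S a) (Q j) ≡ 0ℤ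
  S⊥Q a j = begin
    dot (S a) (Q j)                                  ≡⟨ dot-Q (S a) j ⟩
    L * S a j - sum (λ i → S i j * dot (S a) (S i))  ≡⟨ cong (_-_ (L * S a j)) (sum-cong-≗ gram) ⟩
    L * S a j - sum (λ i → L * S i j * δ a i)        ≡⟨ cong (_-_ (L * S a j)) (∑-δ (λ i → L * S i j) a) ⟩
    L * S a j - L * S a j                            ≡⟨ ℤP.+-inverseʳ (L * S a j) ⟩
    0ℤ                                               ∎
    where
    open ≡-Reasoning
    exchange : ∀ s L d → s * (L * d) ≡ L * s * d
    exchange = solve-∀
    gram : ∀ i → S i j * dot (S a) (S i) ≡ L * S i j * δ a i
    gram i = trans (cong (S i j *_) (gram-S a i)) (exchange (S i j) L (δ a i))

  dot-Q-Q : ∀ k j → dot (Q k) (Q j) ≡ L * Q k j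
  dot-Q-Q k j = begin
    dot (Q k) (Q j)                                  ≡⟨ dot-Q (Q k) j ⟩
    L * Q k j - sum (λ i → S i j * dot (Q k) (S i))  ≡⟨ cong (_-_ (L * Q k j)) (sum-cong-≗ vanish) ⟩
    L * Q k j - sum {m} (λ _ → 0ℤ)                   ≡⟨ cong (_-_ (L * Q k j)) (sum-replicate-zero m) ⟩
    L * Q k j - 0ℤ                                   ≡⟨ ℤP.+-identityʳ (L * Q k j) ⟩
    L * Q k j                                        ∎
    where
    open ≡-Reasoning
    vanish : ∀ i → S i j * dot (Q k) (S i) ≡ 0ℤ
    vanish i = trans (cong (S i j *_) (trans (dot-comm (Q k) (S i)) (S⊥Q i k))) (ℤP.*-zeroʳ (S i j))

  trace-Q : sum (λ k → Q k k) ≡ sum {n} (λ _ → L) - sum {m} (λ _ → L)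
  trace-Q = begin
    sum (λ k → Q k k)
      ≡⟨ ∑-distrib-− {n} (λ k → L * δ k k) (λ k → sum (λ i → S i k * S i k)) ⟩
    sum {n} (λ k → L * δ k k) - sum (λ k → sum (λ i → S i k * S i k))
      ≡⟨ cong₂ _-_ (sum-cong-≗ {n} (λ k → trans (cong (L *_) (δ-diag k)) (ℤP.*-identityʳ L)))
                   (∑-comm {n} {m} (λ k i → S i k * S i k)) ⟩
    sum {n} (λ _ → L) - sum (λ i → sum (λ k → S i k * S i k))
      ≡⟨ cong (_-_ (sum {n} (λ _ → L))) (sum-cong-≗ (λ i → trans (sym (dot≡∑ (S i) (S i))) (normSq-S i))) ⟩
    sum {n} (λ _ → L) - sum {m} (λ _ → L)
      ∎
    where open ≡-Reasoning

nonzero-term : ∀ {n} (f : IVec n) → sum f ≢ 0ℤ → ∃ λ j → f j ≢ 0ℤ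
nonzero-term {zero}  f sum≢0 = ⊥-elim (sum≢0 refl)
nonzero-term {suc n} f sum≢0 with f zero ℤ.≟ 0ℤ
... | no f₀≢0  = zero , f₀≢0
... | yes f₀≡0 with nonzero-term (tail f) (λ rest≡0 → sum≢0 (cong₂ _+_ f₀≡0 rest≡0))
...   | j , fj≢0 = suc j , fj≢0

tabulate-orthogonal : ∀ {n m} (f : Fin m → IVec n) → (∀ i j → i ≢ j → dot (f i) (f j) ≡ 0ℤ) →
  Orthogonal (tabulate f)
tabulate-orthogonal {m = zero}  f orth = []
tabulate-orthogonal {m = suc m} f orth =
  tabulate⁺ (λ j → orth zero (suc j) (λ ()))
    ∷ tabulate-orthogonal (tail f) (λ i j i≢j → orth (suc i) (suc j) (i≢j ∘ FinP.suc-injective))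

normProduct-tabulate : ∀ {n m} (f : Fin m → IVec n) {L} → (∀ i → normSq (f i) ≡ L) → normProduct (tabulate f) ≡ L ^ m
normProduct-tabulate {m = zero}  f norms = refl
normProduct-tabulate {m = suc m} f norms = cong₂ _*_ (norms zero) (normProduct-tabulate (tail f) (norms ∘ suc))

module CodimensionOne {m} (S : Fin m → IVec (suc m)) {L} (L≢0 : L ≢ 0ℤ)
  (normSq-S : ∀ i → normSq (S i) ≡ L) (S-orth : ∀ i j → i ≢ j → dot (S i) (S j) ≡ 0ℤ) where

  open Complement S L normSq-S S-orth public

  trace-Q≡L : sum (λ k → Q k k) ≡ L
  trace-Q≡L = trans trace-Q (cancel L (sum {m} (λ _ → L)))
    where
    cancel : ∀ L X → L + X - X ≡ L
    cancel = solve-∀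

  module Pivot (j : Fin (suc m)) (Qjj≢0 : Q j j ≢ 0ℤ) where

    basis : List (IVec (suc m))
    basis = Q j ∷ tabulate S

    length-basis : length basis ≡ suc m
    length-basis = cong suc (length-tabulate S)

    basis-orthogonal : Orthogonal basis
    basis-orthogonal = tabulate⁺ (λ i → trans (dot-comm (Q j) (S i)) (S⊥Q i j))
                     ∷ tabulate-orthogonal S S-orth

    basis-nonzero : Nonzero basis
    basis-nonzero = (λ eq → *-≢0 L≢0 Qjj≢0 (trans (sym (dot-Q-Q j j)) eq))
                  ∷ tabulate⁺ (λ i eq → L≢0 (trans (sym (normSq-S i)) eq))

    normProduct-basis : normProduct basis ≡ Q j j * L ^ suc m
    normProduct-basis = trans (cong₂ _*_ (dot-Q-Q j j) (normProduct-tabulate S normSq-S))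
                              (regroup L (Q j j) (L ^ m))
      where
      regroup : ∀ L c P → L * c * P ≡ c * (L * P)
      regroup = solve-∀

    Qjj-square : (∃ λ s → s ≢ 0ℤ × L ^ suc m ≡ s * s) → ∃ λ d → Q j j ≡ d * d
    Qjj-square (s , s≢0 , L^n≡s*s) = proj₁ root , proj₂ (proj₂ root)
      where
      det : ∃ λ t → normProduct basis ≡ t * t
      det = orthogonal-basis-normProduct-square basis length-basis basis-orthogonal basis-nonzero
      s*s*Qjj≡t*t : s * s * Q j j ≡ proj₁ det * proj₁ det
      s*s*Qjj≡t*t = begin
        s * s * Q j j          ≡⟨ ℤP.*-comm (s * s) (Q j j) ⟩
        Q j j * (s * s)        ≡⟨ cong (Q j j *_) L^n≡s*s ⟨
        Q j j * L ^ suc m      ≡⟨ normProduct-basis ⟨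
        normProduct basis      ≡⟨ proj₂ det ⟩
        proj₁ det * proj₁ det  ∎
        where open ≡-Reasoning
      root : ∃ λ d → proj₁ det ≡ d * s × Q j j ≡ d * d
      root = square-quotient s (Q j j) (proj₁ det) s≢0 s*s*Qjj≡t*t

    dot-Q-Qj : ∀ k → dot (Q k) (Q j) ≡ L * Q j k
    dot-Q-Qj k = trans (dot-Q-Q k j) (cong (L *_) (Q-sym k j))

    -- Q j j * Q k - Q j k * Q j is orthogonal to the basis, hence null.
    rank-one : ∀ k → Q j j * Q k k ≡ Q j k * Q j k
    rank-one k = ℤP.i-j≡0⇒i≡j _ _ (*-cancelˡ-≡0 (*-≢0 Qjj≢0 L≢0) (trans (sym normSq-q≡) normSq-q≡0))
      where
      c b : ℤ
      c = Q j j
      b = Q j k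
      q : IVec (suc m)
      q = combine c (Q k) (- b) (Q j)
      q⊥Qj : dot q (Q j) ≡ 0ℤ
      q⊥Qj = trans (dot-combineˡ c (Q k) (- b) (Q j) (Q j))
                   (trans (cong₂ (λ x y → c * x + - b * y) (dot-Q-Qj k) (dot-Q-Q j j)) (cancel c L b))
        where
        cancel : ∀ c L b → c * (L * b) + - b * (L * c) ≡ 0ℤ
        cancel = solve-∀
      q⊥basis : q ⊥ basis
      q⊥basis = q⊥Qj ∷ tabulate⁺ (λ i → trans (dot-comm q (S i)) (⊥-combine (S i) c (Q k) (- b) (Q j) (S⊥Q i k) (S⊥Q i j)))
      normSq-q≡0 : normSq q ≡ 0ℤ
      normSq-q≡0 = decidable-stable (normSq q ℤ.≟ 0ℤ) λ q≢0 →
        orthogonal-length≢1+n (q ∷ basis) (q⊥basis ∷ basis-orthogonal) (q≢0 ∷ basis-nonzero) (cong suc length-basis)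
      normSq-q≡ : normSq q ≡ c * L * (c * Q k k - b * b)
      normSq-q≡ = begin
        normSq q
          ≡⟨ dot-combine-combine c (- b) c (- b) (Q k) (Q j) ⟩
        c * c * normSq (Q k) + (c * - b + - b * c) * dot (Q k) (Q j) + - b * - b * normSq (Q j)
          ≡⟨ cong₂ (λ x y → c * c * x + (c * - b + - b * c) * y + - b * - b * normSq (Q j)) (dot-Q-Q k k) (dot-Q-Qj k) ⟩
        c * c * (L * Q k k) + (c * - b + - b * c) * (L * b) + - b * - b * normSq (Q j)
          ≡⟨ cong (λ x → c * c * (L * Q k k) + (c * - b + - b * c) * (L * b) + - b * - b * x) (dot-Q-Q j j) ⟩
        c * c * (L * Q k k) + (c * - b + - b * c) * (L * b) + - b * - b * (L * c)
          ≡⟨ expand c L (Q k k) b ⟩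
        c * L * (c * Q k k - b * b)
          ∎
        where
        open ≡-Reasoning
        expand : ∀ c L a b → c * c * (L * a) + (c * - b + - b * c) * (L * b) + - b * - b * (L * c) ≡ c * L * (c * a - b * b)
        expand = solve-∀

    complement-vector : (∃ λ d → Q j j ≡ d * d) → ∃ λ u → normSq u ≡ L × (∀ i → dot u (S i) ≡ 0ℤ)
    complement-vector (d , Qjj≡d*d) = u , normSq-u , u⊥S
      where
      d≢0 : d ≢ 0ℤ
      d≢0 d≡0 = Qjj≢0 (trans Qjj≡d*d (cong (λ x → x * x) d≡0))
      entry : ∀ k → ∃ λ uₖ → Q j k ≡ uₖ * d × Q k k ≡ uₖ * uₖ
      entry k = square-quotient d (Q k k) (Q j k) d≢0 (trans (cong (_* Q k k) (sym Qjj≡d*d)) (rank-one k))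
      u : IVec (suc m)
      u k = proj₁ (entry k)
      normSq-u : normSq u ≡ L
      normSq-u = trans (dot≡∑ u u) (trans (sum-cong-≗ (λ k → sym (proj₂ (proj₂ (entry k))))) trace-Q≡L)
      u⊥S : ∀ i → dot u (S i) ≡ 0ℤ
      u⊥S i = *-cancelˡ-≡0 d≢0 (begin
        d * dot u (S i)                ≡⟨ cong (d *_) (dot≡∑ u (S i)) ⟩
        d * sum (λ k → u k * S i k)    ≡⟨ *-distribˡ-sum d (λ k → u k * S i k) ⟩
        sum (λ k → d * (u k * S i k))  ≡⟨ sum-cong-≗ row ⟩
        sum (λ k → S i k * Q j k)      ≡⟨ dot≡∑ (S i) (Q j) ⟨
        dot (S i) (Q j)                ≡⟨ S⊥Q i j ⟩
        0ℤ                             ∎)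
        where
        open ≡-Reasoning
        exchange : ∀ d u s → d * (u * s) ≡ s * (u * d)
        exchange = solve-∀
        row : ∀ k → d * (u k * S i k) ≡ S i k * Q j k
        row k = trans (exchange d (u k) (S i k)) (cong (S i k *_) (sym (proj₁ (proj₂ (entry k)))))

◂-orthoregular : ∀ {n k} {S : Fin k → IVec n} (u : IVec n) → Orthoregular S → normSq u ≢ 0ℤ →
  (∀ i → normSq (S i) ≡ normSq u) → (∀ i → dot u (S i) ≡ 0ℤ) → Orthoregular (u ◂ S)
◂-orthoregular {S = S} u (S-orth , _ , _) u≢0 normSq-S u⊥S = orth , (λ a b → trans (norm a) (sym (norm b))) , nonzero
  where
  orth : ∀ a b → a ≢ b → dot ((u ◂ S) a) ((u ◂ S) b) ≡ 0ℤ
  orth zero    zero    a≢b = ⊥-elim (a≢b refl)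
  orth zero    (suc i) _   = u⊥S i
  orth (suc i) zero    _   = trans (dot-comm (S i) u) (u⊥S i)
  orth (suc i) (suc j) a≢b = S-orth i j (a≢b ∘ cong suc)
  norm : ∀ a → normSq ((u ◂ S) a) ≡ normSq u
  norm zero    = refl
  norm (suc i) = normSq-S i
  nonzero : ∀ a → normSq ((u ◂ S) a) ≢ 0ℤ
  nonzero a eq = u≢0 (trans (sym (norm a)) eq)

mainTheorem2 : (n : ℕ) → 2 ≤ n →
    (S : Fin (n ∸ 1) → IVec n) → Orthoregular S →
    (2 ∣ n ⊎ (∃ λ (ℓ : ℤ) → ∀ (i : Fin (n ∸ 1)) → normSq (S i) ≡ ℓ * ℓ)) →
    Σ (Fin n → IVec n) (λ T → Orthoregular T × Contains T S)
mainTheorem2 (suc (suc k)) (s≤s (s≤s z≤n)) S S-orthoregular@(S-orth , S-norms , S-nonzero) hyp =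
  u ◂ S , ◂-orthoregular u S-orthoregular u≢0 (λ i → trans (S-norms i zero) (sym normSq-u)) u⊥S ,
  λ i → suc i , refl
  where
  L = normSq (S zero)
  L≢0 = S-nonzero zero
  open CodimensionOne S L≢0 (λ i → S-norms i zero) S-orth
  diagonal : ∃ λ j → Q j j ≢ 0ℤ
  diagonal = nonzero-term (λ k → Q k k) (λ trace≡0 → L≢0 (trans (sym trace-Q≡L) trace≡0))
  open Pivot (proj₁ diagonal) (proj₂ diagonal)
  root : ∃ λ d → Q (proj₁ diagonal) (proj₁ diagonal) ≡ d * d
  root = Qjj-square (^-square (suc (suc k)) L≢0 (map₂ (λ { (ℓ , sq) → ℓ , sq zero }) hyp))
  extension : ∃ λ u → normSq u ≡ L × (∀ i → dot u (S i) ≡ 0ℤ)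
  extension = complement-vector root
  u = proj₁ extension
  normSq-u = proj₁ (proj₂ extension)
  u⊥S = proj₂ (proj₂ extension)
  u≢0 : normSq u ≢ 0ℤ
  u≢0 u≡0 = L≢0 (trans (sym normSq-u) u≡0)
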